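{- Let $n, m, k, l, s, t$ be positive integers with $\min\{m,n\}\geq (t+1)(k-t+1)$, $k\geq l\geq t+1\geq 4$ and $t+3\leq s \leq k+1$. Then \[(t+1)(k-s+2)(m-l+t-s+2)-(s-1-t)\big((m-l+t-s+1)(n-k-1)-(k-s+2)(l-t)\big)<0.\] -}

{-# OPTIONS --safe #-}

-- Write a = k − s + 2, b = s − 1 − t, p = k − t, P = m − l + t − s + 1,
-- N = n − k − 1 and d = l − t, so that the left-hand side is
-- (t + 1)a(P + 1) − b(PN − ad).  The hypotheses say that the slacks
-- T = t − 3, A = a − 1, B = b − 2, e = k − l, x = m − K and y = n − K,
-- where K = (t + 1)(k − t + 1), are nonnegative; in terms of them
-- N = tp + y, d = p − e and P = (t − 1)p + a + x + e.  Substituting, the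
-- negated left-hand side becomes 1 + bPy + abe + (x + e)G + pH + aJ + A
-- with G = btp − (t + 1)a, H = (t − 1)G − ab and J = G − t − 2, and each
-- of G, H, J is a polynomial in the slacks with nonnegative coefficients.

module Submission where

open import Data.Nat as ℕ using (ℕ; z≤n)
import Data.Nat.Properties as ℕ
open import Data.Integer using (ℤ; +_; _+_; _-_; _*_; _<_; _≤_; 0ℤ; -_; +≤+; -<+)
import Data.Integer.Properties as ℤ
open import Data.Integer.Solver using (module +-*-Solver)
open import Data.Product using (Σ; _,_; proj₂)
open import Relation.Binary.PropositionalEquality using (_≡_; refl; subst; sym)

-- The certificate and the left-hand side are written over an arbitrary
-- signature, so that each can be read both as ring-solver syntax (for the
-- identity lhs≡-[1+slackCertificate]) and as an integer expression; the
-- certificate can moreover be evaluated in ℤ≥0, where it is nonnegative by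
-- construction.

module Certificate {R : Set} (plus times : R → R → R) (# : ℕ → R) where
  infixl 6 _⊕_
  infixl 7 _⊛_
  _⊕_ _⊛_ : R → R → R
  _⊕_ = plus
  _⊛_ = times

  certificate : (T A B e x y : R) → R
  certificate T A B e x y = b ⊛ P ⊛ y ⊕ a ⊛ b ⊛ e ⊕ (x ⊕ e) ⊛ G ⊕ p ⊛ H ⊕ a ⊛ J ⊕ A
    where
    t a b p P G H J : R
    t = # 3 ⊕ T
    a = # 1 ⊕ A
    b = # 2 ⊕ B
    p = # 2 ⊕ A ⊕ B
    P = (# 2 ⊕ T) ⊛ p ⊕ a ⊕ x ⊕ e
    G = (# 1 ⊕ B) ⊛ (# 2 ⊕ T) ⊛ (# 1 ⊕ p) ⊕ B ⊛ (# 1 ⊕ p) ⊕ b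
    H = T ⊛ (# 4 ⊕ T) ⊛ (# 1 ⊕ B) ⊛ (# 1 ⊕ p) ⊕ a ⊛ (# 2 ⊕ # 3 ⊛ B)
        ⊕ # 4 ⊛ b ⊛ (# 1 ⊕ B) ⊕ (# 2 ⊕ T) ⊛ B ⊛ (# 1 ⊕ p) ⊕ (# 2 ⊕ T) ⊛ b
    J = B ⊛ t ⊛ p ⊕ # 2 ⊛ t ⊛ B ⊕ (# 1 ⊕ T) ⊛ (# 2 ⊕ A) ⊕ a

module Polynomials {R : Set} (plus minus times : R → R → R) (# : ℕ → R) where
  infixl 6 _⊕_ _⊖_
  infixl 7 _⊛_
  _⊕_ _⊖_ _⊛_ : R → R → R
  _⊕_ = plus
  _⊖_ = minus
  _⊛_ = times

  bound : (k t : R) → R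
  bound k t = (t ⊕ # 1) ⊛ (k ⊖ t ⊕ # 1)

  lhs : (n m k l s t : R) → R
  lhs n m k l s t = (t ⊕ # 1) ⊛ (k ⊖ s ⊕ # 2) ⊛ (m ⊖ l ⊕ t ⊖ s ⊕ # 2)
    ⊖ (s ⊖ # 1 ⊖ t) ⊛ ((m ⊖ l ⊕ t ⊖ s ⊕ # 1) ⊛ (n ⊖ k ⊖ # 1) ⊖ (k ⊖ s ⊕ # 2) ⊛ (l ⊖ t))

  slackCertificate : (n m k l s t : R) → R
  slackCertificate n m k l s t = Certificate.certificate plus times #
    (t ⊖ # 3) (k ⊕ # 1 ⊖ s) (s ⊖ (t ⊕ # 3)) (k ⊖ l) (m ⊖ bound k t) (n ⊖ bound k t)

open Polynomials _+_ _-_ _*_ +_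

lhs≡-[1+slackCertificate] : ∀ n m k l s t →
  lhs n m k l s t ≡ - (+ 1 + slackCertificate n m k l s t)
lhs≡-[1+slackCertificate] = solve 6 (λ n m k l s t →
  Symbolic.lhs n m k l s t := :- (con (+ 1) :+ Symbolic.slackCertificate n m k l s t)) refl
  where
  open +-*-Solver
  module Symbolic = Polynomials _:+_ _:-_ _:*_ (λ c → con (+ c))

ℤ≥0 : Set
ℤ≥0 = Σ ℤ (0ℤ ≤_)

*-nonNeg : ∀ {i j} → 0ℤ ≤ i → 0ℤ ≤ j → 0ℤ ≤ i * j
*-nonNeg (+≤+ {n = i} _) (+≤+ {n = j} _) = subst (0ℤ ≤_) (ℤ.pos-* i j) (+≤+ z≤n)

_+≥0_ _*≥0_ : ℤ≥0 → ℤ≥0 → ℤ≥0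
(i , 0≤i) +≥0 (j , 0≤j) = i + j , ℤ.+-mono-≤ 0≤i 0≤j
(i , 0≤i) *≥0 (j , 0≤j) = i * j , *-nonNeg 0≤i 0≤j

certificate-nonNeg : ∀ {T A B e x y} →
  0ℤ ≤ T → 0ℤ ≤ A → 0ℤ ≤ B → 0ℤ ≤ e → 0ℤ ≤ x → 0ℤ ≤ y →
  0ℤ ≤ Certificate.certificate _+_ _*_ +_ T A B e x y
certificate-nonNeg 0≤T 0≤A 0≤B 0≤e 0≤x 0≤y =
  proj₂ (Certificate.certificate _+≥0_ _*≥0_ (λ c → + c , +≤+ z≤n)
           (_ , 0≤T) (_ , 0≤A) (_ , 0≤B) (_ , 0≤e) (_ , 0≤x) (_ , 0≤y))

-[1+nonNeg]<0 : ∀ {i} → 0ℤ ≤ i → - (+ 1 + i) < 0ℤ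
-[1+nonNeg]<0 (+≤+ _) = -<+

lhs<0 : ∀ {n m k l s t} → + 3 ≤ t → t + + 3 ≤ s → s ≤ k + + 1 → l ≤ k →
  bound k t ≤ m → bound k t ≤ n → lhs n m k l s t < 0ℤ
lhs<0 {n} {m} {k} {l} {s} {t} 3≤t t+3≤s s≤k+1 l≤k K≤m K≤n =
  subst (_< 0ℤ) (sym (lhs≡-[1+slackCertificate] n m k l s t))
    (-[1+nonNeg]<0 (certificate-nonNeg (slack 3≤t) (slack s≤k+1) (slack t+3≤s)
                                        (slack l≤k) (slack K≤m) (slack K≤n)))
  where
  slack : ∀ {i j} → i ≤ j → 0ℤ ≤ j - i
  slack = ℤ.i≤j⇒0≤j-i

lemma3p2 : (n m k l s t : ℕ) →
    1 ℕ.≤ n → 1 ℕ.≤ m → 1 ℕ.≤ k → 1 ℕ.≤ l → 1 ℕ.≤ s → 1 ℕ.≤ t →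
    (+ t + + 1) * (+ k - + t + + 1) ≤ + m →
    (+ t + + 1) * (+ k - + t + + 1) ≤ + n →
    l ℕ.≤ k → t ℕ.+ 1 ℕ.≤ l → 4 ℕ.≤ t ℕ.+ 1 →
    t ℕ.+ 3 ℕ.≤ s → s ℕ.≤ k ℕ.+ 1 →
    (+ t + + 1) * (+ k - + s + + 2) * (+ m - + l + + t - + s + + 2)
      - (+ s - + 1 - + t) * ((+ m - + l + + t - + s + + 1) * (+ n - + k - + 1) - (+ k - + s + + 2) * (+ l - + t))
      < + 0
lemma3p2 n m k l s t _ _ _ _ _ _ K≤m K≤n l≤k _ 4≤t+1 t+3≤s s≤k+1 =
  lhs<0 (+≤+ (ℕ.+-cancelʳ-≤ 1 3 t 4≤t+1)) (+≤+ t+3≤s) (+≤+ s≤k+1) (+≤+ l≤k) K≤m K≤n
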